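{- Let $n\ge1$ and let $K$ be a connected pure $n$-simplicial complex such that (1) between any two distinct $(n-1)$-simplices of $K$ there exists a unique reduced $(n-1,n)$-path sequence, and (2) for every $0\le m\le n-2$, $K$ contains no $(m,n)$-simplicial cycle sequence. Then $K$ is a simplicial tree.
   Context: A simplicial complex on a finite vertex set is a collection of non-empty vertex subsets containing all singletons and closed under non-empty subsets; a $k$-simplex has $k+1$ vertices; $\tau$ is a face of $\sigma$ if $\tau\subseteq\sigma$. $K$ is a pure $n$-simplicial complex if $\dim K=n$ and every simplex is a face of some $n$-simplex. Let $0\le m\le n-1$. An $(m,n)$-walk sequence between $m$-simplices $\sigma,\sigma'$ is an alternating sequence $\sigma=\sigma_1,\eta_1,\sigma_2,\dots,\sigma_r,\eta_r,\sigma_{r+1}=\sigma'$ of $m$-simplices $\sigma_k$ and $n$-simplices $\eta_k$ with $\sigma_k\neq\sigma_{k+1}$ both faces of $\eta_k$; it is an $(m,n)$-path sequence if all its simplices are distinct. $K$ is connected if there is an $(n-1,n)$-path sequence between every pair of distinct $(n-1)$-simplices. An $(m,n)$-path sequence is reduced if (i) among $\eta_1,\dots,\eta_r$, $\sigma_1$ is a face only of $\eta_1$ and $\sigma_{r+1}$ is a face only of $\eta_r$; (ii) for each $2\le z\le r$ there is an $(n-1)$-simplex $\sigma'_z$ of $K$ which is a face of both $\eta_{z-1}$ and $\eta_z$ and has $\sigma_z$ as a face, with $\sigma'_x\ne\sigma'_y$ for $2\le x\ne y\le r$. An $(m,n)$-simplicial cycle sequence is an $(m,n)$-walk sequence with $\sigma_{r+1}=\sigma_1$,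 $\sigma_p\ne\sigma_q$ and $\eta_p\ne\eta_q$ for $1\le p\ne q\le r$, such that $r\ge3$, $\sigma_1$ is not a face of $\eta_k$ for $2\le k\le r-1$, and condition (ii) holds. $K$ is acyclic if it contains no $(m,n)$-simplicial cycle sequence for any $0\le m\le n-1$; a simplicial tree is a connected acyclic pure $n$-simplicial complex. -}

module Defs where

open import Data.Nat using (ℕ; zero; suc; _≤_; _<_; _+_; _∸_)
open import Data.Bool using (Bool; T)
open import Data.Fin using (Fin)
open import Data.Fin.Subset using (Subset; _⊆_; ⁅_⁆; ∣_∣; Nonempty)
open import Data.Product using (Σ; ∃; _×_)
open import Relation.Binary.PropositionalEquality using (_≡_; _≢_)
open import Relation.Nullary using (¬_)

-- A simplicial complex on the finite vertex set Fin V: a (finite, hence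
-- decidable) collection of non-empty vertex subsets containing all
-- singletons and closed under non-empty subsets.
record SimplicialComplex (V : ℕ) : Set where
  field
    simplex   : Subset V → Bool
    nonempty  : ∀ σ → T (simplex σ) → Nonempty σ
    singleton : ∀ (v : Fin V) → T (simplex ⁅ v ⁆)
    closed    : ∀ σ τ → T (simplex σ) → Nonempty τ → τ ⊆ σ → T (simplex τ)
open SimplicialComplex public

module _ {V : ℕ} (K : SimplicialComplex V) where

  Simp : ℕ → Subset V → Set
  Simp k σ = T (simplex K σ) × ∣ σ ∣ ≡ suc k

  HasDim : ℕ → Set
  HasDim n = (∃ λ σ → Simp n σ) × (∀ σ → T (simplex K σ) → ∣ σ ∣ ≤ suc n)

  Pure : ℕ → Set
  Pure n = HasDim n × (∀ σ → T (simplex K σ) → ∃ λ η → Simp n η × σ ⊆ η)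

  -- Sequences are encoded 0-based: σs 0, ηs 0, σs 1, …, σs (r-1), ηs (r-1), σs r.
  -- Only the values at indices in range (σs k for k ≤ r, ηs k for k < r) matter.
  -- (1-based σ_{k+1} is σs k, 1-based η_{k+1} is ηs k.)

  record Walk (m n r : ℕ) (σs ηs : ℕ → Subset V) : Set where
    field
      σ-simp : ∀ k → k ≤ r → Simp m (σs k)
      η-simp : ∀ k → k < r → Simp n (ηs k)
      step-≢ : ∀ k → k < r → σs k ≢ σs (suc k)
      step-l : ∀ k → k < r → σs k ⊆ ηs k
      step-r : ∀ k → k < r → σs (suc k) ⊆ ηs k

  record PathSeq (m n r : ℕ) (σs ηs : ℕ → Subset V) : Set where
    field
      walk   : Walk m n r σs ηs
      σ-inj  : ∀ p q → p ≤ r → q ≤ r → p ≢ q → σs p ≢ σs q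
      η-inj  : ∀ p q → p < r → q < r → p ≢ q → ηs p ≢ ηs q
      ση-dis : ∀ p q → p ≤ r → q < r → σs p ≢ ηs q

  -- condition (ii): for each 1-based 2 ≤ z ≤ r (0-based 1 ≤ z ≤ r-1) an
  -- (n-1)-simplex σ'_z, face of η_{z-1} and η_z, having σ_z as a face,
  -- pairwise distinct.
  CondII : (n r : ℕ) (σs ηs : ℕ → Subset V) → Set
  CondII n r σs ηs =
    Σ (ℕ → Subset V) λ σ' →
      (∀ z → 1 ≤ z → z < r →
         Simp (n ∸ 1) (σ' z) × σ' z ⊆ ηs (z ∸ 1) × σ' z ⊆ ηs z × σs z ⊆ σ' z)
      × (∀ x y → 1 ≤ x → x < r → 1 ≤ y → y < r → x ≢ y → σ' x ≢ σ' y)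

  record ReducedPath (m n r : ℕ) (σs ηs : ℕ → Subset V) : Set where
    field
      path   : PathSeq m n r σs ηs
      first  : ∀ k → k < r → σs 0 ⊆ ηs k → k ≡ 0
      last   : ∀ k → k < r → σs r ⊆ ηs k → suc k ≡ r
      condII : CondII n r σs ηs

  Between : (r : ℕ) (σs : ℕ → Subset V) (σ σ' : Subset V) → Set
  Between r σs σ σ' = (σs 0 ≡ σ) × (σs r ≡ σ')

  SameSeq : (r : ℕ) (σs ηs : ℕ → Subset V) (r' : ℕ) (σs' ηs' : ℕ → Subset V) → Set
  SameSeq r σs ηs r' σs' ηs' =
    (r ≡ r') × (∀ k → k ≤ r → σs k ≡ σs' k) × (∀ k → k < r → ηs k ≡ ηs' k)

  record CycleSeq (m n r : ℕ) (σs ηs : ℕ → Subset V) : Set where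
    field
      walk    : Walk m n r σs ηs
      closes  : σs r ≡ σs 0
      σ-inj   : ∀ p q → p < r → q < r → p ≢ q → σs p ≢ σs q
      η-inj   : ∀ p q → p < r → q < r → p ≢ q → ηs p ≢ ηs q
      len     : 3 ≤ r
      -- 1-based: σ_1 not a face of η_k for 2 ≤ k ≤ r-1
      notFace : ∀ k → 1 ≤ k → k + 2 ≤ r → ¬ (σs 0 ⊆ ηs k)
      condII  : CondII n r σs ηs

  HasCycle : (m n : ℕ) → Set
  HasCycle m n = Σ ℕ λ r → Σ (ℕ → Subset V) λ σs → Σ (ℕ → Subset V) λ ηs →
    CycleSeq m n r σs ηs

  Connected : ℕ → Set
  Connected n = ∀ σ σ' → Simp (n ∸ 1) σ → Simp (n ∸ 1) σ' → σ ≢ σ' →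
    Σ ℕ λ r → Σ (ℕ → Subset V) λ σs → Σ (ℕ → Subset V) λ ηs →
      PathSeq (n ∸ 1) n r σs ηs × Between r σs σ σ'

  UniqueReducedPaths : ℕ → Set
  UniqueReducedPaths n = ∀ σ σ' → Simp (n ∸ 1) σ → Simp (n ∸ 1) σ' → σ ≢ σ' →
    (Σ ℕ λ r → Σ (ℕ → Subset V) λ σs → Σ (ℕ → Subset V) λ ηs →
      ReducedPath (n ∸ 1) n r σs ηs × Between r σs σ σ')
    × (∀ r σs ηs r' σs' ηs' →
         ReducedPath (n ∸ 1) n r σs ηs → Between r σs σ σ' →
         ReducedPath (n ∸ 1) n r' σs' ηs' → Between r' σs' σ σ' →
         SameSeq r σs ηs r' σs' ηs')

  Acyclic : ℕ → Set
  Acyclic n = ∀ m → m < n → ¬ HasCycle m n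

  SimplicialTree : ℕ → Set
  SimplicialTree n = Connected n × Acyclic n × Pure n

-- Hypothesis (2) leaves only the (n-1,n)-cycles to exclude, and such a cycle
-- σ₁ η₁ σ₂ … σ_r η_r σ₁ yields two different reduced paths from σ₁ to σ₂.
-- One is σ₁ η₁ σ₂. For the other let η_k be the last simplex of the cycle
-- containing σ₂ and walk the cycle backwards: σ₁ η_r σ_r … σ_{k+1} η_k σ₂.
-- It is reduced at σ₁ because the cycle forbids σ₁ ⊆ η_j for 2 ≤ j ≤ r-1, at
-- σ₂ by the choice of k, and condition (ii) holds with σ'_z = σ_z because the
-- σ_z are themselves (n-1)-simplices. It starts with η_r ≠ η₁.
module Submission where

open import Defs
open import Data.Nat using (ℕ; zero; suc; _≤_; _<_; _+_; _∸_; z≤n; s≤s; z<s; _<?_; _≤?_)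
open import Data.Nat.Properties
open import Data.Fin.Subset using (Subset; _⊆_)
open import Data.Fin.Subset.Properties using (⊆-refl; _⊆?_)
open import Data.Product using (_×_; _,_; proj₂)
open import Data.Sum using (inj₁; inj₂)
open import Data.Empty using (⊥-elim)
open import Function using (_∘_)
open import Relation.Nullary using (¬_; Dec; yes; no; contradiction)
open import Relation.Binary.PropositionalEquality

record Greatest (P : ℕ → Set) (a t : ℕ) : Set where
  field
    index    : ℕ
    lower    : a ≤ index
    upper    : index ≤ t
    holds    : P index
    maximal  : ∀ j → index < j → j ≤ t → ¬ P j

greatest : ∀ {P : ℕ → Set} → (∀ i → Dec (P i)) → ∀ {a} t → P a → a ≤ t → Greatest P a t
greatest P? zero pa a≤0 =
  record { lower = ≤-refl ; upper = a≤0 ; holds = pa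
         ; maximal = λ j a<j j≤0 → contradiction (<-≤-trans a<j j≤0) n≮0 }
greatest {P} P? {a} (suc t) pa a≤1+t with P? (suc t)
... | yes p =
  record { lower = a≤1+t ; upper = ≤-refl ; holds = p
         ; maximal = λ j 1+t<j j≤1+t → contradiction (<-≤-trans 1+t<j j≤1+t) (<-irrefl refl) }
... | no ¬p = record { lower = G.lower ; upper = ≤-trans G.upper (n≤1+n t) ; holds = G.holds
                     ; maximal = maximal′ }
  where
  G : Greatest P a t
  G = greatest P? t pa (≤-pred (≤∧≢⇒< a≤1+t λ { refl → ¬p pa }))
  module G = Greatest G

  maximal′ : ∀ j → G.index < j → j ≤ suc t → ¬ P j
  maximal′ j i<j j≤1+t with m≤n⇒m<n∨m≡n j≤1+t
  ... | inj₁ j<1+t = G.maximal j i<j (≤-pred j<1+t)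
  ... | inj₂ refl = ¬p

suc[m∸suc[n]]≡m∸n : ∀ {m n} → n < m → suc (m ∸ suc n) ≡ m ∸ n
suc[m∸suc[n]]≡m∸n n<m = sym (+-∸-assoc 1 n<m)

module _ {V : ℕ} {K : SimplicialComplex V} where

  Simp-dim-≢ : ∀ {m n σ η} → m ≢ n → Simp K m σ → Simp K n η → σ ≢ η
  Simp-dim-≢ m≢n (_ , ∣σ∣≡1+m) (_ , ∣η∣≡1+n) refl =
    m≢n (suc-injective (trans (sym ∣σ∣≡1+m) ∣η∣≡1+n))

  Walk-prefix : ∀ {m n r r′ σs ηs} → r′ ≤ r → Walk K m n r σs ηs → Walk K m n r′ σs ηs
  Walk-prefix r′≤r w = record
    { σ-simp = λ k k≤r′ → σ-simp k (≤-trans k≤r′ r′≤r)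
    ; η-simp = λ k k<r′ → η-simp k (<-≤-trans k<r′ r′≤r)
    ; step-≢ = λ k k<r′ → step-≢ k (<-≤-trans k<r′ r′≤r)
    ; step-l = λ k k<r′ → step-l k (<-≤-trans k<r′ r′≤r)
    ; step-r = λ k k<r′ → step-r k (<-≤-trans k<r′ r′≤r)
    }
    where open Walk w

  module _ {m r : ℕ} {σs ηs : ℕ → Subset V} where

    PathSeq-codim1 : (w : Walk K m (suc m) r σs ηs) →
      (∀ p q → p ≤ r → q ≤ r → p ≢ q → σs p ≢ σs q) →
      (∀ p q → p < r → q < r → p ≢ q → ηs p ≢ ηs q) →
      PathSeq K m (suc m) r σs ηs
    PathSeq-codim1 w σ-inj η-inj = record
      { walk = w ; σ-inj = σ-inj ; η-inj = η-inj
      ; ση-dis = λ p q p≤r q<r → Simp-dim-≢ (≢-sym (1+n≢n {m})) (σ-simp p p≤r) (η-simp q q<r)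
      }
      where open Walk w

    CondII-codim1 : PathSeq K m (suc m) r σs ηs → CondII K (suc m) r σs ηs
    CondII-codim1 P = σs , faces , λ x y _ x<r _ y<r → σ-inj x y (<⇒≤ x<r) (<⇒≤ y<r)
      where
      open PathSeq P
      open Walk walk
      faces : ∀ z → 1 ≤ z → z < r →
        Simp K m (σs z) × σs z ⊆ ηs (z ∸ 1) × σs z ⊆ ηs z × σs z ⊆ σs z
      faces (suc z) _ z<r = σ-simp (suc z) (<⇒≤ z<r) , step-r z (<⇒≤ z<r) , step-l (suc z) z<r , ⊆-refl

    ReducedPath-codim1 : (P : PathSeq K m (suc m) r σs ηs) →
      (∀ k → k < r → σs 0 ⊆ ηs k → k ≡ 0) →
      (∀ k → k < r → σs r ⊆ ηs k → suc k ≡ r) →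
      ReducedPath K m (suc m) r σs ηs
    ReducedPath-codim1 P first last =
      record { path = P ; first = first ; last = last ; condII = CondII-codim1 P }

  edge-ReducedPath : ∀ {m σs ηs} → Walk K m (suc m) 1 σs ηs → ReducedPath K m (suc m) 1 σs ηs
  edge-ReducedPath {σs = σs} {ηs} w =
    ReducedPath-codim1 (PathSeq-codim1 w σ-inj η-inj) only-0 (λ { _ (s≤s z≤n) _ → refl })
    where
    open Walk w
    σ-inj : ∀ p q → p ≤ 1 → q ≤ 1 → p ≢ q → σs p ≢ σs q
    σ-inj _ _ z≤n       z≤n       0≢0 = contradiction refl 0≢0
    σ-inj _ _ z≤n       (s≤s z≤n) _   = step-≢ 0 ≤-refl
    σ-inj _ _ (s≤s z≤n) z≤n       _   = ≢-sym (step-≢ 0 ≤-refl)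
    σ-inj _ _ (s≤s z≤n) (s≤s z≤n) 1≢1 = contradiction refl 1≢1
    η-inj : ∀ p q → p < 1 → q < 1 → p ≢ q → ηs p ≢ ηs q
    η-inj _ _ (s≤s z≤n) (s≤s z≤n) 0≢0 = contradiction refl 0≢0
    only-0 : ∀ k → k < 1 → σs 0 ⊆ ηs k → k ≡ 0
    only-0 _ (s≤s z≤n) _ = refl

  module ReturnPath {m r : ℕ} {σs ηs : ℕ → Subset V} (C : CycleSeq K m (suc m) r σs ηs) where
    open CycleSeq C
    open Walk walk

    1<r : 1 < r
    1<r = ≤-trans (s≤s (s≤s z≤n)) len

    0<r : 0 < r
    0<r = <-trans z<s 1<r

    r∸1<r : r ∸ 1 < r
    r∸1<r = ∸-monoʳ-< z<s 0<r

    σ-inj-cyclic : ∀ {p q} → 1 ≤ p → p ≤ r → 1 ≤ q → q ≤ r → p ≢ q → σs p ≢ σs q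
    σ-inj-cyclic {p} {q} 1≤p p≤r 1≤q q≤r p≢q with m≤n⇒m<n∨m≡n p≤r | m≤n⇒m<n∨m≡n q≤r
    ... | inj₁ p<r | inj₁ q<r = σ-inj p q p<r q<r p≢q
    ... | inj₁ p<r | inj₂ refl = σ-inj p 0 p<r 0<r (≢-sym (<⇒≢ 1≤p)) ∘ (λ e → trans e closes)
    ... | inj₂ refl | inj₁ q<r = σ-inj 0 q 0<r q<r (<⇒≢ 1≤q) ∘ trans (sym closes)
    ... | inj₂ refl | inj₂ refl = contradiction refl p≢q

    lastFaceOfσ₁ : Greatest (λ j → σs 1 ⊆ ηs j) 1 (r ∸ 1)
    lastFaceOfσ₁ = greatest (λ j → σs 1 ⊆? ηs j) (r ∸ 1) (step-l 1 1<r) (∸-monoˡ-≤ 1 1<r)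

    open Greatest lastFaceOfσ₁
      renaming (index to k; lower to 1≤k; upper to k≤r∸1; holds to σ₁⊆η-k; maximal to σ₁⊈η-after-k)

    k<r : k < r
    k<r = ≤-<-trans k≤r∸1 r∸1<r

    L : ℕ
    L = r ∸ k

    0<L : 0 < L
    0<L = m<n⇒0<n∸m k<r

    L≤r : L ≤ r
    L≤r = m∸n≤m r k

    r∸L≡k : r ∸ L ≡ k
    r∸L≡k = m∸[m∸n]≡n (<⇒≤ k<r)

    -- The return path is σs r (= σs 0), σs (r ∸ 1), …, σs (k + 1), σs 1; its i-th simplex
    -- is σs (back i), which is why injectivity is needed on 1 … r rather than 0 … r ∸ 1.
    back : ℕ → ℕ
    back i with i <? L
    ... | yes _ = r ∸ i
    ... | no _ = 1

    back-< : ∀ {i} → i < L → back i ≡ r ∸ i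
    back-< {i} i<L with i <? L
    ... | yes _ = refl
    ... | no i≮L = contradiction i<L i≮L

    back-L : back L ≡ 1
    back-L with L <? L
    ... | yes L<L = contradiction L<L (<-irrefl refl)
    ... | no _ = refl

    k<r∸ : ∀ {i} → i < L → k < r ∸ i
    k<r∸ i<L = subst (_< _) r∸L≡k (∸-monoʳ-< i<L L≤r)

    1<back : ∀ {i} → i < L → 1 < back i
    1<back i<L = subst (1 <_) (sym (back-< i<L)) (≤-<-trans 1≤k (k<r∸ i<L))

    back-range : ∀ {i} → i ≤ L → 1 ≤ back i × back i ≤ r
    back-range {i} i≤L with m≤n⇒m<n∨m≡n i≤L
    ... | inj₁ i<L = <⇒≤ (1<back i<L) , subst (_≤ r) (sym (back-< i<L)) (m∸n≤m r i)
    ... | inj₂ refl = subst (1 ≤_) (sym back-L) ≤-refl , subst (_≤ r) (sym back-L) 0<r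

    back-injective : ∀ {i j} → i ≤ L → j ≤ L → back i ≡ back j → i ≡ j
    back-injective {i} {j} i≤L j≤L e with m≤n⇒m<n∨m≡n i≤L | m≤n⇒m<n∨m≡n j≤L
    ... | inj₁ i<L | inj₁ j<L =
      ∸-cancelˡ-≡ (<⇒≤ (<-≤-trans i<L L≤r)) (<⇒≤ (<-≤-trans j<L L≤r))
        (trans (sym (back-< i<L)) (trans e (back-< j<L)))
    ... | inj₁ i<L | inj₂ refl = contradiction (1<back i<L) (<-irrefl (sym (trans e back-L)))
    ... | inj₂ refl | inj₁ j<L = contradiction (1<back j<L) (<-irrefl (trans (sym back-L) e))
    ... | inj₂ refl | inj₂ refl = refl

    σs′ : ℕ → Subset V
    σs′ = σs ∘ back

    ηs′ : ℕ → Subset V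
    ηs′ i = ηs (r ∸ suc i)

    η-index< : ∀ {i} → i < L → r ∸ suc i < r
    η-index< i<L = ∸-monoʳ-< z<s (≤-trans i<L L≤r)

    k≤η-index : ∀ {i} → i < L → k ≤ r ∸ suc i
    k≤η-index i<L = subst (_≤ _) r∸L≡k (∸-monoʳ-≤ r i<L)

    σ′-inj : ∀ p q → p ≤ L → q ≤ L → p ≢ q → σs′ p ≢ σs′ q
    σ′-inj p q p≤L q≤L p≢q with back-range p≤L | back-range q≤L
    ... | 1≤p , p≤r | 1≤q , q≤r = σ-inj-cyclic 1≤p p≤r 1≤q q≤r (p≢q ∘ back-injective p≤L q≤L)

    enters : ∀ i → i < L → σs′ i ⊆ ηs′ i
    enters i i<L =
      subst (λ x → σs x ⊆ ηs′ i)
        (trans (suc[m∸suc[n]]≡m∸n (<-≤-trans i<L L≤r)) (sym (back-< i<L)))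
        (step-r (r ∸ suc i) (η-index< i<L))

    leaves : ∀ i → i < L → σs′ (suc i) ⊆ ηs′ i
    leaves i i<L with m≤n⇒m<n∨m≡n i<L
    ... | inj₁ 1+i<L = subst (λ x → σs x ⊆ ηs′ i) (sym (back-< 1+i<L)) (step-l _ (η-index< i<L))
    ... | inj₂ 1+i≡L =
      subst₂ (λ x y → σs x ⊆ ηs y)
        (sym (trans (cong back 1+i≡L) back-L)) (sym (trans (cong (r ∸_) 1+i≡L) r∸L≡k)) σ₁⊆η-k

    walk′ : Walk K m (suc m) L σs′ ηs′
    walk′ = record
      { σ-simp = λ i i≤L → σ-simp (back i) (proj₂ (back-range i≤L))
      ; η-simp = λ i i<L → η-simp (r ∸ suc i) (η-index< i<L)
      ; step-≢ = λ i i<L → σ′-inj i (suc i) (<⇒≤ i<L) i<L (≢-sym 1+n≢n)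
      ; step-l = enters
      ; step-r = leaves
      }

    η′-inj : ∀ p q → p < L → q < L → p ≢ q → ηs′ p ≢ ηs′ q
    η′-inj p q p<L q<L p≢q = η-inj _ _ (η-index< p<L) (η-index< q<L)
      (p≢q ∘ suc-injective ∘ ∸-cancelˡ-≡ (≤-trans p<L L≤r) (≤-trans q<L L≤r))

    starts-at-σ₀ : σs′ 0 ≡ σs 0
    starts-at-σ₀ = trans (cong σs (back-< 0<L)) closes

    first′ : ∀ j → j < L → σs′ 0 ⊆ ηs′ j → j ≡ 0
    first′ zero _ _ = refl
    first′ (suc j) 2+j<L σ₀⊆ =
      ⊥-elim (notFace h 1≤h h+2≤r (subst (_⊆ ηs h) starts-at-σ₀ σ₀⊆))
      where
      h : ℕ
      h = r ∸ suc (suc j)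
      1≤h : 1 ≤ h
      1≤h = ≤-trans 1≤k (k≤η-index 2+j<L)
      h+2≤r : h + 2 ≤ r
      h+2≤r = subst (h + 2 ≤_) (m∸n+n≡m (≤-trans 2+j<L L≤r)) (+-monoʳ-≤ h (s≤s (s≤s z≤n)))

    last′ : ∀ j → j < L → σs′ L ⊆ ηs′ j → suc j ≡ L
    last′ j j<L σ₁⊆ with m≤n⇒m<n∨m≡n j<L
    ... | inj₂ 1+j≡L = 1+j≡L
    ... | inj₁ 1+j<L =
      ⊥-elim (σ₁⊈η-after-k (r ∸ suc j) (k<r∸ 1+j<L) (∸-monoʳ-≤ r (s≤s z≤n))
                (subst (_⊆ ηs′ j) (cong σs back-L) σ₁⊆))

    returnPath : ReducedPath K m (suc m) L σs′ ηs′
    returnPath = ReducedPath-codim1 (PathSeq-codim1 walk′ σ′-inj η′-inj) first′ last′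

    returnPath-between : Between K L σs′ (σs 0) (σs 1)
    returnPath-between = starts-at-σ₀ , cong σs back-L

  UniqueReducedPaths⇒¬HasCycle-codim1 : ∀ {m} → UniqueReducedPaths K (suc m) → ¬ HasCycle K m (suc m)
  UniqueReducedPaths⇒¬HasCycle-codim1 U (r , σs , ηs , C) =
    η-inj 0 (r ∸ 1) 0<r r∸1<r (<⇒≢ (m<n⇒0<n∸m 1<r)) (proj₂ (proj₂ same-path) 0 z<s)
    where
    open CycleSeq C
    open Walk walk
    open ReturnPath C
    same-path : SameSeq K 1 σs ηs L σs′ ηs′
    same-path = proj₂ (U (σs 0) (σs 1) (σ-simp 0 z≤n) (σ-simp 1 (<⇒≤ 1<r)) (step-≢ 0 0<r))
      1 σs ηs L σs′ ηs′ (edge-ReducedPath (Walk-prefix 0<r walk)) (refl , refl)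
      returnPath returnPath-between

m<n∧m+2≰n⇒n≡1+m : ∀ {m n} → m < n → ¬ m + 2 ≤ n → n ≡ suc m
m<n∧m+2≰n⇒n≡1+m {m} {n} m<n m+2≰n = ≤-antisym (≤-pred (subst (n <_) (+-comm m 2) (≰⇒> m+2≰n))) m<n

corollary5p1 : ∀ {V : ℕ} (K : SimplicialComplex V) (n : ℕ) → 1 ≤ n →
    Pure K n → Connected K n → UniqueReducedPaths K n →
    (∀ m → m + 2 ≤ n → ¬ HasCycle K m n) →
    SimplicialTree K n
corollary5p1 K n _ pure connected unique no-low-cycles = connected , acyclic , pure
  where
  acyclic : Acyclic K n
  acyclic m m<n with m + 2 ≤? n
  ... | yes m+2≤n = no-low-cycles m m+2≤n
  ... | no m+2≰n = UniqueReducedPaths⇒¬HasCycle-codim1 (subst (UniqueReducedPaths K) n≡1+m unique)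
                 ∘ subst (HasCycle K m) n≡1+m
    where
    n≡1+m : n ≡ suc m
    n≡1+m = m<n∧m+2≰n⇒n≡1+m m<n m+2≰n
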